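{- Let $G$ be a $2$-cograph and let $e$ be an edge of $G$. Then $G/e$ is a $2$-cograph.
   Context: All graphs are finite and simple; $\overline{G}$ denotes the complement of $G$. A graph is $2$-connected if it has at least three vertices, is connected, and has no cut vertex. A graph $G$ is a $2$-cograph if $G$ has no induced subgraph $H$ such that both $H$ and $\overline{H}$ are $2$-connected. For an edge $e$ of $G$, $G/e$ denotes the simple graph obtained by contracting $e$ and then deleting all but one edge from each class of parallel edges. -}

module Defs where

open import Data.Bool using (Bool; true; false; not; _∧_; _∨_)
open import Data.Bool.Properties using (∨-comm)
open import Data.Nat using (ℕ; suc; _≤_)
open import Data.Fin using (Fin; punchIn; _≟_)
open import Data.Product using (_×_)
open import Function.Definitions using (Injective)
open import Relation.Binary.PropositionalEquality using (_≡_; refl; sym; cong; cong₂)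
open import Relation.Nullary using (¬_; yes; no)
open import Relation.Nullary.Decidable using (⌊_⌋)

eqb : ∀ {n} → Fin n → Fin n → Bool
eqb i j = ⌊ i ≟ j ⌋

eqb-sym : ∀ {n} (i j : Fin n) → eqb i j ≡ eqb j i
eqb-sym i j with i ≟ j | j ≟ i
... | yes _ | yes _ = refl
... | no _ | no _ = refl
... | yes p | no q = Relation.Nullary.contradiction (sym p) q
... | no p | yes q = Relation.Nullary.contradiction (sym q) p

eqb-refl : ∀ {n} (i : Fin n) → eqb i i ≡ true
eqb-refl i with i ≟ i
... | yes _ = refl
... | no q = Relation.Nullary.contradiction refl q

record Graph (n : ℕ) : Set where
  field
    adj    : Fin n → Fin n → Bool
    adj-sym    : ∀ i j → adj i j ≡ adj j i
    adj-irrefl : ∀ i → adj i i ≡ false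
open Graph public

complement : ∀ {n} → Graph n → Graph n
complement G = record
  { adj    = λ i j → not (eqb i j) ∧ not (adj G i j)
  ; adj-sym    = λ i j → cong₂ (λ a b → not a ∧ not b) (eqb-sym i j) (adj-sym G i j)
  ; adj-irrefl = λ i → cong (λ a → not a ∧ not (adj G i i)) (eqb-refl i)
  }

induced : ∀ {n m} → Graph n → (Fin m → Fin n) → Graph m
induced G f = record
  { adj    = λ i j → adj G (f i) (f j)
  ; adj-sym    = λ i j → adj-sym G (f i) (f j)
  ; adj-irrefl = λ i → adj-irrefl G (f i)
  }

delete : ∀ {m} → Graph (suc m) → Fin (suc m) → Graph m
delete G v = induced G (punchIn v)

data Reach {n} (G : Graph n) : Fin n → Fin n → Set where
  here  : ∀ {u} → Reach G u u
  there : ∀ {u w v} → adj G u w ≡ true → Reach G w v → Reach G u v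

Connected : ∀ {n} → Graph n → Set
Connected G = ∀ u v → Reach G u v

CutVertex : ∀ {m} → Graph (suc m) → Fin (suc m) → Set
CutVertex G v = ¬ Connected (delete G v)

data TwoConnected : ∀ {n} → Graph n → Set where
  twoConn : ∀ {m} (G : Graph (suc m)) → 3 ≤ suc m → Connected G →
            (∀ v → ¬ CutVertex G v) → TwoConnected G

TwoCograph : ∀ {n} → Graph n → Set
TwoCograph {n} G = ∀ m (f : Fin m → Fin n) → Injective _≡_ _≡_ f →
  ¬ (TwoConnected (induced G f) × TwoConnected (complement (induced G f)))

-- Contraction of the edge uv: vertex v is deleted (remaining vertices are
-- enumerated by punchIn v) and u becomes the merged vertex, adjacent to
-- every neighbour of u or of v; loops and parallel edges are discarded.
private
  mergedAdj : ∀ {m} → Graph (suc m) → (u v : Fin (suc m)) → Fin (suc m) → Fin (suc m) → Bool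
  mergedAdj G u v x y = adj G x y ∨ (eqb x u ∧ adj G v y)

contract : ∀ {m} → Graph (suc m) → (u v : Fin (suc m)) → Graph m
contract G u v = record
  { adj    = λ i j → C i j
  ; adj-sym    = λ i j → cong₂ (λ a b → not a ∧ b) (eqb-sym i j)
                       (∨-comm (M (punchIn v i) (punchIn v j)) (M (punchIn v j) (punchIn v i)))
  ; adj-irrefl = λ i → cong (λ a → not a ∧ (M (punchIn v i) (punchIn v i) ∨ M (punchIn v i) (punchIn v i))) (eqb-refl i)
  }
  where
  M = mergedAdj G u v
  C : _ → _ → Bool
  C i j = not (eqb i j) ∧ (M (punchIn v i) (punchIn v j) ∨ M (punchIn v j) (punchIn v i))

-- Let H be an induced subgraph of G/uv with H and its complement 2-connected.
-- If H avoids the merged vertex, or that vertex's neighbourhood in H is the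
-- neighbourhood of u alone or of v alone, then H is already an induced
-- subgraph of G.  Otherwise u has a neighbour a in H not adjacent to v and v
-- has a neighbour b not adjacent to u; the induced subgraph K of G on the
-- vertices of H together with both u and v has K/uv = H, and a and b let
-- every walk of H, or of its complement, be rerouted in K, or in its
-- complement, around any single deleted vertex.  So K and its complement are
-- 2-connected as well.
module Submission where

open import Defs
open import Data.Bool using (true; false; not; _∧_; _∨_)
open import Data.Bool.Properties using (∨-idem; ∨-identityʳ) renaming (_≟_ to _≟ᵇ_)
open import Data.Empty using (⊥; ⊥-elim)
open import Data.Fin using (Fin; zero; suc; punchIn; punchOut; _≟_)
open import Data.Fin.Properties
  using (any?; suc-injective; punchIn-injective; punchInᵢ≢i; punchIn-punchOut)
open import Data.Fin.Permutation.Components using (transpose; transpose-inverse)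
open import Data.Nat using (ℕ; suc; _≤_; s≤s)
open import Data.Nat.Properties using (m≤n⇒m≤1+n)
open import Data.Product using (_×_; _,_; ∃; proj₁; proj₂)
open import Data.Sum using (_⊎_; inj₁; inj₂)
open import Data.Unit using (⊤; tt)
open import Data.Vec.Functional using (_∷_)
open import Function using (_∘_)
open import Function.Definitions using (Injective)
open import Relation.Binary.PropositionalEquality
open import Relation.Nullary using (¬_; Dec; yes; no)
open import Relation.Nullary.Decidable using (_×-dec_; ¬?; dec-true; dec-false)
open import Relation.Nullary.Negation using (¬¬-map)

private
  variable
    k n : ℕ

not∧not-true⁻¹ : ∀ {a b} → not a ∧ not b ≡ true → a ≡ false × b ≡ false
not∧not-true⁻¹ {false} {false} _ = refl , refl

not∧not-true : ∀ {a b} → a ≡ false → b ≡ false → not a ∧ not b ≡ true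
not∧not-true refl refl = refl

∨-false⁻¹ : ∀ {a b} → a ∨ b ≡ false → a ≡ false × b ≡ false
∨-false⁻¹ {false} {false} _ = refl , refl

∨-true⁻¹ : ∀ {a b} → a ∨ b ≡ true → a ≡ true ⊎ b ≡ true
∨-true⁻¹ {true}  _ = inj₁ refl
∨-true⁻¹ {false} b = inj₂ b

∨-absorbʳ : ∀ {a b} → (b ≡ true → a ≡ true) → a ∨ b ≡ a
∨-absorbʳ {true}          _ = refl
∨-absorbʳ {false} {false} _ = refl
∨-absorbʳ {false} {true}  h with () ← h refl

∨-absorbˡ : ∀ {a b} → (a ≡ true → b ≡ true) → a ∨ b ≡ b
∨-absorbˡ {false}        _ = refl
∨-absorbˡ {true} {true}  _ = refl
∨-absorbˡ {true} {false} h with () ← h refl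

eqb-≢ : {x y : Fin n} → ¬ x ≡ y → eqb x y ≡ false
eqb-≢ {x = x} {y} x≢y with x ≟ y
... | yes x≡y = ⊥-elim (x≢y x≡y)
... | no  _   = refl

eqb-suc : (i j : Fin n) → eqb (suc i) (suc j) ≡ eqb i j
eqb-suc i j with i ≟ j
... | yes _ = refl
... | no  _ = refl

adj-loop : (H : Graph n) {x y : Fin n} → adj H x y ≡ true → ¬ x ≡ y
adj-loop H {x} e refl with () ← trans (sym e) (adj-irrefl H x)

fresh-vertex-zero : (y : Fin (suc (suc (suc n)))) → ∃ λ z → ¬ z ≡ zero × ¬ z ≡ y
fresh-vertex-zero y with suc zero ≟ y
... | yes refl = suc (suc zero) , (λ ()) , (λ ())
... | no 1≢y   = suc zero , (λ ()) , 1≢y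

fresh-vertex : 3 ≤ n → (x y : Fin n) → ∃ λ z → ¬ z ≡ x × ¬ z ≡ y
fresh-vertex (s≤s (s≤s (s≤s _))) x y with zero ≟ x | zero ≟ y
... | no 0≢x   | no 0≢y   = zero , 0≢x , 0≢y
... | yes refl | _        = fresh-vertex-zero y
... | no _     | yes refl with z , z≢0 , z≢x ← fresh-vertex-zero x = z , z≢x , z≢0

_≈_ : Graph n → Graph n → Set
H ≈ K = ∀ i j → adj H i j ≡ adj K i j

≈-offDiagonal : (H K : Graph n) → (∀ {i j} → ¬ i ≡ j → adj H i j ≡ adj K i j) → H ≈ K
≈-offDiagonal H K off i j with i ≟ j
... | yes refl = trans (adj-irrefl H i) (sym (adj-irrefl K i))
... | no i≢j   = off i≢j

complement-≈ : {H K : Graph n} → H ≈ K → complement H ≈ complement K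
complement-≈ H≈K i j = cong (λ b → not (eqb i j) ∧ not b) (H≈K i j)

∷-injective : {A : Set} {a : A} {g : Fin k → A} →
  (∀ i → ¬ g i ≡ a) → Injective _≡_ _≡_ g → Injective _≡_ _≡_ (a ∷ g)
∷-injective a∉g g-inj {zero}  {zero}  _ = refl
∷-injective a∉g g-inj {zero}  {suc j} e = ⊥-elim (a∉g j (sym e))
∷-injective a∉g g-inj {suc i} {zero}  e = ⊥-elim (a∉g i e)
∷-injective a∉g g-inj {suc i} {suc j} e = cong suc (g-inj e)

transpose-suc-injective : (i : Fin n) → Injective _≡_ _≡_ (transpose (suc i) zero ∘ suc)
transpose-suc-injective i {x} {y} e = suc-injective (begin
  suc x                                                   ≡⟨ transpose-inverse zero (suc i) ⟨
  transpose zero (suc i) (transpose (suc i) zero (suc x)) ≡⟨ cong (transpose zero (suc i)) e ⟩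
  transpose zero (suc i) (transpose (suc i) zero (suc y)) ≡⟨ transpose-inverse zero (suc i) ⟩
  suc y                                                   ∎)
  where open ≡-Reasoning

transpose-suc-here : (i : Fin n) → transpose (suc i) zero (suc i) ≡ zero
transpose-suc-here i rewrite dec-true (i ≟ i) refl = refl

transpose-suc-away : {i j : Fin n} → ¬ j ≡ i → transpose (suc i) zero (suc j) ≡ suc j
transpose-suc-away {i = i} {j} j≢i rewrite dec-false (j ≟ i) j≢i = refl

punchIn-∘-injective : (v : Fin (suc n)) {f : Fin k → Fin n} →
  Injective _≡_ _≡_ f → Injective _≡_ _≡_ (punchIn v ∘ f)
punchIn-∘-injective v f-inj e = f-inj (punchIn-injective v _ _ e)

-- Walks all of whose vertices satisfy P; with P = Avoiding v they stand in
-- for walks of delete H v without reindexing along punchIn.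
data Walk (H : Graph n) (P : Fin n → Set) : Fin n → Fin n → Set where
  stop : ∀ {x} → P x → Walk H P x x
  step : ∀ {x y z} → P x → adj H x y ≡ true → Walk H P y z → Walk H P x z

Linked : Graph n → (Fin n → Set) → Set
Linked {n} H P = ∀ (y z : Fin n) → P y → P z → Walk H P y z

Avoiding : Fin n → Fin n → Set
Avoiding v x = ¬ x ≡ v

Everywhere : Fin n → Set
Everywhere _ = ⊤

module _ {H : Graph n} {P : Fin n → Set} where

  Walk-start : ∀ {x y} → Walk H P x y → P x
  Walk-start (stop p)     = p
  Walk-start (step p _ _) = p

  _++ʷ_ : ∀ {x y z} → Walk H P x y → Walk H P y z → Walk H P x z
  stop _     ++ʷ w′ = w′
  step p e w ++ʷ w′ = step p e (w ++ʷ w′)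

  Walk-reverse : ∀ {x y} → Walk H P x y → Walk H P y x
  Walk-reverse (stop p) = stop p
  Walk-reverse {x} (step {y = y} p e w) =
    Walk-reverse w ++ʷ step (Walk-start w) (trans (adj-sym H y x) e) (stop p)

  Walk-firstStep : ∀ {x z} → Walk H P x z → ¬ x ≡ z → ∃ λ d → adj H x d ≡ true × P d
  Walk-firstStep (stop _)             x≢x = ⊥-elim (x≢x refl)
  Walk-firstStep (step {y = y} _ e w) _   = y , e , Walk-start w

  linked-viaHub : (h : Fin n) → (∀ y → P y → Walk H P y h) → Linked H P
  linked-viaHub h toHub y z py pz = toHub y py ++ʷ Walk-reverse (toHub z pz)

Walk-map : ∀ {m} {H : Graph n} {K : Graph m} {P : Fin n → Set} {Q : Fin m → Set}
  (φ : Fin n → Fin m) → (∀ {x} → P x → Q (φ x)) →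
  (∀ {x y} → P x → P y → adj H x y ≡ true → Walk K Q (φ x) (φ y)) →
  ∀ {x y} → Walk H P x y → Walk K Q (φ x) (φ y)
Walk-map φ pq edge (stop p)     = stop (pq p)
Walk-map φ pq edge (step p e w) = edge p (Walk-start w) e ++ʷ Walk-map φ pq edge w

Walk-≈ : {H K : Graph n} {P : Fin n → Set} → H ≈ K → ∀ {x y} → Walk H P x y → Walk K P x y
Walk-≈ {H = H} H≈K = Walk-map (λ x → x) (λ p → p)
  (λ {x} {y} px py e → step px (trans (sym (H≈K x y)) e) (stop py))

reach⇒walk : {H : Graph n} {x y : Fin n} → Reach H x y → Walk H Everywhere x y
reach⇒walk here        = stop tt
reach⇒walk (there e r) = step tt e (reach⇒walk r)

walk⇒reach : {H : Graph n} {P : Fin n → Set} {x y : Fin n} → Walk H P x y → Reach H x y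
walk⇒reach (stop _)     = here
walk⇒reach (step _ e w) = there e (walk⇒reach w)

module _ {H : Graph (suc n)} {v : Fin (suc n)} where

  reach-delete⇒walk : ∀ {a b} → Reach (delete H v) a b →
                      Walk H (Avoiding v) (punchIn v a) (punchIn v b)
  reach-delete⇒walk {a} here        = stop (punchInᵢ≢i v a)
  reach-delete⇒walk {a} (there e r) = step (punchInᵢ≢i v a) e (reach-delete⇒walk r)

  walk⇒reach-delete : ∀ {y z} → Walk H (Avoiding v) y z →
                      ∀ a b → punchIn v a ≡ y → punchIn v b ≡ z → Reach (delete H v) a b
  walk⇒reach-delete (stop _) a b refl vb≡va
    with refl ← punchIn-injective v a b (sym vb≡va) = here
  walk⇒reach-delete (step {y = y} _ e w) a b refl vb≡z =
    there (subst (λ t → adj H (punchIn v a) t ≡ true) (sym a′↦y) e)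
          (walk⇒reach-delete w a′ b a′↦y vb≡z)
    where
    a′ = punchOut (λ v≡y → Walk-start w (sym v≡y))
    a′↦y : punchIn v a′ ≡ y
    a′↦y = punchIn-punchOut _

  connected-delete⇒linked : Connected (delete H v) → Linked H (Avoiding v)
  connected-delete⇒linked c y z y≢v z≢v =
    subst₂ (Walk H (Avoiding v))
      (punchIn-punchOut (y≢v ∘ sym)) (punchIn-punchOut (z≢v ∘ sym))
      (reach-delete⇒walk (c _ _))

  linked⇒connected-delete : Linked H (Avoiding v) → Connected (delete H v)
  linked⇒connected-delete l a b =
    walk⇒reach-delete (l _ _ (punchInᵢ≢i v a) (punchInᵢ≢i v b)) a b refl refl

twoConnected⇒ : {H : Graph n} → TwoConnected H →
  3 ≤ n × Linked H Everywhere × (∀ v → ¬ ¬ Linked H (Avoiding v))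
twoConnected⇒ (twoConn H 3≤n c noCut) =
  3≤n , (λ y z _ _ → reach⇒walk (c y z)) ,
  λ v → ¬¬-map connected-delete⇒linked (noCut v)

twoConnected⇐ : (H : Graph n) → 3 ≤ n → Linked H Everywhere →
  (∀ v → ¬ ¬ Linked H (Avoiding v)) → TwoConnected H
twoConnected⇐ {suc _} H 3≤n l avoid = twoConn H 3≤n
  (λ y z → walk⇒reach (l y z tt tt))
  (λ v → ¬¬-map linked⇒connected-delete (avoid v))

twoConnected-≈ : {H K : Graph n} → H ≈ K → TwoConnected H → TwoConnected K
twoConnected-≈ {K = K} H≈K tc with 3≤n , l , avoid ← twoConnected⇒ tc =
  twoConnected⇐ K 3≤n (λ y z py pz → Walk-≈ H≈K (l y z py pz))
    (λ v → ¬¬-map (λ lv y z py pz → Walk-≈ H≈K (lv y z py pz)) (avoid v))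

twoConnected-neighbour : {H : Graph n} → TwoConnected H →
  ∀ x s → ¬ s ≡ x → ∃ λ d → ¬ d ≡ s × adj H x d ≡ true
twoConnected-neighbour {H = H} tc x s s≢x
  with any? (λ d → ¬? (d ≟ s) ×-dec (adj H x d ≟ᵇ true))
... | yes found = found
... | no none with 3≤n , _ , avoid ← twoConnected⇒ tc
                 with z , z≢x , z≢s ← fresh-vertex 3≤n x s =
  ⊥-elim (avoid s λ ls →
    let d , e , d≢s = Walk-firstStep (ls x z (s≢x ∘ sym) z≢s) (z≢x ∘ sym)
    in none (d , d≢s , e))

twoCograph-induced : {G : Graph n} {f : Fin k → Fin n} →
  TwoCograph G → Injective _≡_ _≡_ f → TwoCograph (induced G f)
twoCograph-induced {f = f} cog f-inj m h h-inj = cog m (f ∘ h) (h-inj ∘ f-inj)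

twoCograph-excludes : {G : Graph n} {H : Graph k} {f : Fin k → Fin n} →
  TwoCograph G → Injective _≡_ _≡_ f → H ≈ induced G f →
  TwoConnected H → TwoConnected (complement H) → ⊥
twoCograph-excludes {k = k} {G = G} {H = H} {f = f} cog f-inj H≈ tcH tcHᶜ =
  cog k f f-inj
    (twoConnected-≈ H≈ tcH , twoConnected-≈ (complement-≈ {H = H} {K = induced G f} H≈) tcHᶜ)

-- K refines H by splitting the vertex i0 of H into suc i0 and zero; every
-- other vertex i of H is suc i in K.
module Split {H : Graph k} {K : Graph (suc k)} {i0 : Fin k}
  (lift-away : ∀ {i j} → ¬ i ≡ i0 → ¬ j ≡ i0 → adj H i j ≡ true → adj K (suc i) (suc j) ≡ true)
  (lift-at : ∀ {j} → adj H i0 j ≡ true →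
             adj K (suc i0) (suc j) ≡ true ⊎ (adj K (suc i0) zero ≡ true × adj K zero (suc j) ≡ true))
  where

  -- An edge at i0 may lift to a detour through zero, hence the hypothesis on P i0.
  liftWalk : {P : Fin k → Set} {Q : Fin (suc k) → Set} →
    (∀ {i} → P i → Q (suc i)) → (P i0 → Q zero) →
    ∀ {x y} → Walk H P x y → Walk K Q (suc x) (suc y)
  liftWalk {P} {Q} pq p0 = Walk-map suc pq liftEdge
    where
    liftEdgeAt : ∀ {y} → P i0 → P y → adj H i0 y ≡ true → Walk K Q (suc i0) (suc y)
    liftEdgeAt p py e with lift-at e
    ... | inj₁ e′        = step (pq p) e′ (stop (pq py))
    ... | inj₂ (e₁ , e₂) = step (pq p) e₁ (step (p0 p) e₂ (stop (pq py)))

    liftEdge : ∀ {x y} → P x → P y → adj H x y ≡ true → Walk K Q (suc x) (suc y)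
    liftEdge {x} {y} px py e with x ≟ i0 | y ≟ i0
    ... | yes refl | _        = liftEdgeAt px py e
    ... | no _     | yes refl = Walk-reverse (liftEdgeAt py px (trans (adj-sym H i0 x) e))
    ... | no x≢i0  | no y≢i0  = step (pq px) (lift-away x≢i0 y≢i0 e) (stop (pq py))

  twoConnected-split :
    (∃ λ a → ¬ a ≡ i0 × adj K (suc i0) (suc a) ≡ true) →
    (∃ λ b → ¬ b ≡ i0 × adj K zero (suc b) ≡ true) →
    (∀ s → ¬ s ≡ i0 → ∃ λ d → ¬ d ≡ s × adj K zero (suc d) ≡ true) →
    TwoConnected H → TwoConnected K
  twoConnected-split (a , a≢i0 , i0a) (b , b≢i0 , 0b) zero-neighbour tc
    with 3≤k , linkedH , avoidH ← twoConnected⇒ tc =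
    twoConnected⇐ K (m≤n⇒m≤1+n 3≤k) linkedK avoidK
    where
    suc-avoiding : ∀ {s i} → Avoiding s i → Avoiding (suc s) (suc i)
    suc-avoiding i≢s = i≢s ∘ suc-injective

    linkedK : Linked K Everywhere
    linkedK = linked-viaHub (suc i0) λ where
      zero    _ → step tt 0b (liftWalk _ _ (linkedH b i0 tt tt))
      (suc j) _ → liftWalk _ _ (linkedH j i0 tt tt)

    avoid-zero : Linked H (Avoiding i0) → Linked K (Avoiding zero)
    avoid-zero l = linked-viaHub (suc a) toA
      where
      toA : ∀ y → Avoiding zero y → Walk K (Avoiding zero) y (suc a)
      toA zero 0≢0 = ⊥-elim (0≢0 refl)
      toA (suc j) p with j ≟ i0
      ... | yes refl = step p i0a (stop λ ())
      ... | no j≢i0  = liftWalk (λ _ ()) (λ i0≢i0 → ⊥-elim (i0≢i0 refl)) (l j a j≢i0 a≢i0)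

    avoid-i0 : Linked H (Avoiding i0) → Linked K (Avoiding (suc i0))
    avoid-i0 l = linked-viaHub (suc b) λ where
      zero    _ → step (λ ()) 0b (stop (suc-avoiding b≢i0))
      (suc j) p → liftWalk suc-avoiding (λ i0≢i0 → ⊥-elim (i0≢i0 refl))
                    (l j b (p ∘ cong suc) b≢i0)

    avoid-other : ∀ {s} → ¬ s ≡ i0 → Linked H (Avoiding s) → Linked K (Avoiding (suc s))
    avoid-other {s} s≢i0 l = linked-viaHub (suc i0) λ where
      zero    _ → let d , d≢s , 0d = zero-neighbour s s≢i0 in
                  step (λ ()) 0d (liftWalk suc-avoiding (λ _ ()) (l d i0 d≢s (s≢i0 ∘ sym)))
      (suc j) p → liftWalk suc-avoiding (λ _ ()) (l j i0 (p ∘ cong suc) (s≢i0 ∘ sym))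

    avoidK : ∀ x → ¬ ¬ Linked K (Avoiding x)
    avoidK zero = ¬¬-map avoid-zero (avoidH i0)
    avoidK (suc s) with s ≟ i0
    ... | yes refl = ¬¬-map avoid-i0 (avoidH i0)
    ... | no s≢i0  = ¬¬-map (avoid-other s≢i0) (avoidH s)

-- H arises from K by identifying the vertex zero of K with suc i0; every other
-- vertex i of H is suc i in K.
record Merges (H : Graph k) (K : Graph (suc k)) (i0 : Fin k) : Set where
  field
    merge-away : ∀ {i j} → ¬ i ≡ j → ¬ i ≡ i0 → ¬ j ≡ i0 → adj H i j ≡ adj K (suc i) (suc j)
    merge-at   : ∀ {j} → ¬ j ≡ i0 → adj H i0 j ≡ adj K (suc i0) (suc j) ∨ adj K zero (suc j)

module _ {H : Graph k} {K : Graph (suc k)} {i0 : Fin k} (M : Merges H K i0) where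
  open Merges M

  merges-≈-induced : (h : Fin k → Fin (suc k)) → (∀ {i} → ¬ i ≡ i0 → h i ≡ suc i) →
    (∀ {j} → ¬ j ≡ i0 → adj H i0 j ≡ adj K (h i0) (suc j)) → H ≈ induced K h
  merges-≈-induced h h-away h-at = ≈-offDiagonal H (induced K h) off
    where
    at : ∀ {j} → ¬ j ≡ i0 → adj H i0 j ≡ adj K (h i0) (h j)
    at j≢i0 = trans (h-at j≢i0) (cong (adj K (h i0)) (sym (h-away j≢i0)))

    off : ∀ {i j} → ¬ i ≡ j → adj H i j ≡ adj K (h i) (h j)
    off {i} {j} i≢j with i ≟ i0 | j ≟ i0
    ... | yes refl | yes refl = ⊥-elim (i≢j refl)
    ... | yes refl | no j≢i0  = at j≢i0
    ... | no i≢i0  | yes refl = trans (adj-sym H i i0) (trans (at i≢i0) (adj-sym K (h i0) (h i)))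
    ... | no i≢i0  | no j≢i0  =
      trans (merge-away i≢j i≢i0 j≢i0) (sym (cong₂ (adj K) (h-away i≢i0) (h-away j≢i0)))

  PrivateNeighbour : Fin (suc k) → Fin (suc k) → Set
  PrivateNeighbour x y = ∃ λ j → ¬ j ≡ i0 × adj K x (suc j) ≡ true × adj K y (suc j) ≡ false

  privateNeighbour? : ∀ x y → Dec (PrivateNeighbour x y)
  privateNeighbour? x y =
    any? λ j → ¬? (j ≟ i0) ×-dec (adj K x (suc j) ≟ᵇ true) ×-dec (adj K y (suc j) ≟ᵇ false)

  ¬privateNeighbour : ∀ {x y} → ¬ PrivateNeighbour x y →
    ∀ {j} → ¬ j ≡ i0 → adj K x (suc j) ≡ true → adj K y (suc j) ≡ true
  ¬privateNeighbour {y = y} none {j} j≢i0 xj with adj K y (suc j) in yj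
  ... | true  = refl
  ... | false = ⊥-elim (none (j , j≢i0 , xj , yj))

  merges-≈-without-zero : ¬ PrivateNeighbour zero (suc i0) → H ≈ induced K suc
  merges-≈-without-zero none = merges-≈-induced suc (λ _ → refl) λ j≢i0 →
    trans (merge-at j≢i0) (∨-absorbʳ (¬privateNeighbour none j≢i0))

  merges-≈-without-i0 : ¬ PrivateNeighbour (suc i0) zero →
    H ≈ induced K (transpose (suc i0) zero ∘ suc)
  merges-≈-without-i0 none =
    merges-≈-induced (transpose (suc i0) zero ∘ suc) transpose-suc-away λ {j} j≢i0 → begin
      adj H i0 j                                       ≡⟨ merge-at j≢i0 ⟩
      adj K (suc i0) (suc j) ∨ adj K zero (suc j)      ≡⟨ ∨-absorbˡ (¬privateNeighbour none j≢i0) ⟩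
      adj K zero (suc j)                               ≡⟨ cong (λ t → adj K t (suc j)) (transpose-suc-here i0) ⟨
      adj K (transpose (suc i0) zero (suc i0)) (suc j) ∎
    where open ≡-Reasoning

  merge-complement-at : ∀ {j} → adj (complement H) i0 j ≡ true →
    adj (complement K) (suc i0) (suc j) ≡ true × adj (complement K) zero (suc j) ≡ true
  merge-complement-at {j} e
    with i0≢j , i0j-false ← not∧not-true⁻¹ {eqb i0 j} {adj H i0 j} e
    with u-false , v-false ←
           ∨-false⁻¹ (trans (sym (merge-at (adj-loop (complement H) e ∘ sym))) i0j-false) =
    not∧not-true (trans (eqb-suc i0 j) i0≢j) u-false , not∧not-true refl v-false

  twoConnected-unmerge-complement : PrivateNeighbour (suc i0) zero → PrivateNeighbour zero (suc i0) →
    TwoConnected (complement H) → TwoConnected (complement K)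
  twoConnected-unmerge-complement (a , a≢i0 , _ , 0a-false) (b , b≢i0 , _ , i0b-false) tcHᶜ =
    Split.twoConnected-split {H = complement H} {K = complement K} {i0 = i0}
      (λ {i} {j} i≢i0 j≢i0 e → trans (cong₂ (λ p q → not p ∧ not q)
        (eqb-suc i j) (sym (merge-away (adj-loop (complement H) e) i≢i0 j≢i0))) e)
      (inj₁ ∘ proj₁ ∘ merge-complement-at)
      (b , b≢i0 , not∧not-true (trans (eqb-suc i0 b) (eqb-≢ (b≢i0 ∘ sym))) i0b-false)
      (a , a≢i0 , not∧not-true refl 0a-false)
      (λ s s≢i0 → let d , d≢s , i0d = twoConnected-neighbour tcHᶜ i0 s s≢i0
                  in d , d≢s , proj₂ (merge-complement-at i0d))
      tcHᶜ

  module _ (edge : adj K zero (suc i0) ≡ true) where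

    merge-lift-at : ∀ {j} → adj H i0 j ≡ true →
      adj K (suc i0) (suc j) ≡ true ⊎ (adj K (suc i0) zero ≡ true × adj K zero (suc j) ≡ true)
    merge-lift-at e with ∨-true⁻¹ (trans (sym (merge-at (adj-loop H e ∘ sym))) e)
    ... | inj₁ i0j = inj₁ i0j
    ... | inj₂ 0j  = inj₂ (trans (adj-sym K (suc i0) zero) edge , 0j)

    twoConnected-unmerge : PrivateNeighbour (suc i0) zero → PrivateNeighbour zero (suc i0) →
      TwoConnected H → TwoConnected K
    twoConnected-unmerge (a , a≢i0 , i0a , _) (b , b≢i0 , 0b , _) =
      Split.twoConnected-split
        (λ i≢i0 j≢i0 e → trans (sym (merge-away (adj-loop H e) i≢i0 j≢i0)) e)
        merge-lift-at (a , a≢i0 , i0a) (b , b≢i0 , 0b) (λ s s≢i0 → i0 , (s≢i0 ∘ sym) , edge)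

    merge-excludes : TwoCograph K → TwoConnected H → TwoConnected (complement H) → ⊥
    merge-excludes cog tcH tcHᶜ
      with privateNeighbour? (suc i0) zero | privateNeighbour? zero (suc i0)
    ... | _     | no none = twoCograph-excludes {G = K} {f = suc} cog suc-injective
                              (merges-≈-without-zero none) tcH tcHᶜ
    ... | no none | _     = twoCograph-excludes {G = K} {f = transpose (suc i0) zero ∘ suc} cog
                              (transpose-suc-injective i0) (merges-≈-without-i0 none) tcH tcHᶜ
    ... | yes a | yes b   = cog (suc k) (λ x → x) (λ e → e)
                              (twoConnected-unmerge a b tcH , twoConnected-unmerge-complement a b tcHᶜ)

contract-adj-away : (G : Graph (suc n)) (u v : Fin (suc n)) {x y : Fin n} → ¬ x ≡ y →
  ¬ punchIn v x ≡ u → ¬ punchIn v y ≡ u →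
  adj (contract G u v) x y ≡ adj G (punchIn v x) (punchIn v y)
contract-adj-away G u v {x} {y} x≢y x≢u y≢u
  rewrite eqb-≢ x≢y | eqb-≢ x≢u | eqb-≢ y≢u | adj-sym G (punchIn v y) (punchIn v x) =
  trans (∨-idem _) (∨-identityʳ _)

contract-adj-merged : (G : Graph (suc n)) (v : Fin (suc n)) {x y : Fin n} → ¬ x ≡ y →
  adj (contract G (punchIn v x) v) x y ≡ adj G (punchIn v x) (punchIn v y) ∨ adj G v (punchIn v y)
contract-adj-merged G v {x} {y} x≢y
  rewrite eqb-≢ x≢y | eqb-refl (punchIn v x) | eqb-≢ (x≢y ∘ sym ∘ punchIn-injective v y x)
        | adj-sym G (punchIn v y) (punchIn v x)
  with adj G (punchIn v x) (punchIn v y)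
... | true  = refl
... | false = ∨-identityʳ _

module _ (G : Graph (suc n)) (u v : Fin (suc n)) {f : Fin k → Fin n}
         (f-inj : Injective _≡_ _≡_ f) where

  private
    g : Fin k → Fin (suc n)
    g = punchIn v ∘ f

  contract-induced-≈ : (∀ i → ¬ g i ≡ u) → induced (contract G u v) f ≈ induced G g
  contract-induced-≈ u∉g = ≈-offDiagonal (induced (contract G u v) f) (induced G g) λ {i} {j} i≢j →
    contract-adj-away G u v (i≢j ∘ f-inj) (u∉g i) (u∉g j)

  contract-induced-merges : ∀ {i0} → g i0 ≡ u →
    Merges (induced (contract G u v) f) (induced G (v ∷ g)) i0
  contract-induced-merges {i0} g-i0≡u = record
    { merge-away = λ i≢j i≢i0 j≢i0 →
        contract-adj-away G u v (i≢j ∘ f-inj) (other i≢i0) (other j≢i0)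
    ; merge-at = λ {j} j≢i0 →
        subst (λ w → adj (contract G w v) (f i0) (f j) ≡ adj G (g i0) (g j) ∨ adj G v (g j))
          g-i0≡u (contract-adj-merged G v (j≢i0 ∘ sym ∘ f-inj))
    }
    where
    other : ∀ {i} → ¬ i ≡ i0 → ¬ g i ≡ u
    other i≢i0 gi≡u = i≢i0 (punchIn-∘-injective v f-inj (trans gi≡u (sym g-i0≡u)))

lemma2p4 : (m : ℕ) (G : Graph (suc m)) (u v : Fin (suc m)) →
    TwoCograph G → adj G u v ≡ true → TwoCograph (contract G u v)
lemma2p4 m G u v cog uv k f f-inj (tcH , tcHᶜ) with any? (λ i → punchIn v (f i) ≟ u)
... | no u∉H =
  twoCograph-excludes {G = G} {f = punchIn v ∘ f} cog (punchIn-∘-injective v f-inj)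
    (contract-induced-≈ G u v f-inj λ i e → u∉H (i , e)) tcH tcHᶜ
... | yes (i0 , g-i0≡u) =
  merge-excludes (contract-induced-merges G u v f-inj g-i0≡u) vu cogK tcH tcHᶜ
  where
  vu : adj G v (punchIn v (f i0)) ≡ true
  vu = subst (λ w → adj G v w ≡ true) (sym g-i0≡u) (trans (adj-sym G v u) uv)

  cogK : TwoCograph (induced G (v ∷ punchIn v ∘ f))
  cogK = twoCograph-induced {G = G} {f = v ∷ punchIn v ∘ f} cog
           (∷-injective (punchInᵢ≢i v ∘ f) (punchIn-∘-injective v f-inj))
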